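{- If $V$ satisfies (BF), (Cm) and (Cn), then $V$ satisfies (SMN): for all natural numbers $m,n$ there is a $V$-function $s$ such that for all natural numbers $k_1,\dots,k_m$ and all $e\in\mathsf I_{m+n}$ we have $s(e,k_1,\dots,k_m)\in\mathsf I_n$ and $\varphi^V_{s(e,k_1,\dots,k_m)}(x_1,\dots,x_n)\simeq\varphi^V_e(x_1,\dots,x_n,k_1,\dots,k_m)$.
   Context: Let $\mathsf c:\mathbb N^2\to\mathbb N$ be a bijection and $\mathsf p_1,\mathsf p_2$ the functions with $\mathsf p_1(\mathsf c(a,b))=a$, $\mathsf p_2(\mathsf c(a,b))=b$; $I^i_n(a_1,\dots,a_n)=a_i$ for $n\ge1$, $1\le i\le n$. $V$ is a countable set of partial functions with arguments and values in $\mathbb N$ (arities $n\ge0$); a $V$-function is a member of $V$; $V_n$ is the set of $n$-ary $V$-functions. For each $n\ge0$ a numbering is fixed: a set $\mathsf I_n\subseteq\mathbb N$ and a map $e\mapsto\varphi^V_e$ from $\mathsf I_n$ onto $V_n$. $t_1\simeq t_2$ means that for every assignment of numbers to the variables, both sides are undefined or both are defined and equal. (BF): $I^i_n$ (all $n\ge1$, $1\le i\le n$), $\mathsf c,\mathsf p_1,\mathsf p_2$ are $V$-functions. (Cm): for all $n,m_1,\dots,m_n$, with $m=\max_i m_i$, there is an $(n+1)$-ary $V$-function $s$ with $s(e,e_1,\dots,e_n)\in\mathsf I_m$ and $\varphi^V_{s(e,e_1,\dots,e_n)}(x_1,\dots,x_m)\simeq\varphi^V_e(\varphi^V_{e_1}(x_1,\dots,x_{m_1}),\dots,\varphi^V_{e_n}(x_1,\dots,x_{m_n}))$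 for all $e\in\mathsf I_n$, $e_i\in\mathsf I_{m_i}$. (Cn): there is a $V$-function $s$ with $s(k)\in\mathsf I_0$ and $\varphi^V_{s(k)}\simeq k$ for all $k\in\mathbb N$. -}

module Defs where

open import Data.Nat using (ℕ; zero; suc; _+_; _⊔_)
open import Data.Nat.Properties using (+-comm)
open import Data.Fin using (Fin)
open import Data.Vec using (Vec; []; _∷_; lookup; _++_; foldr; cast)
open import Data.Product using (Σ; ∃; _×_; _,_)
open import Relation.Binary.PropositionalEquality using (_≡_)

-- An n-ary partial function on ℕ, represented by its graph:
-- f xs y  means  "f(xs) is defined and equals y".
-- (Single-valuedness is imposed separately where needed.)
PRel : ℕ → Set₁
PRel n = Vec ℕ n → ℕ → Set

_≃_ : ∀ {n} → PRel n → PRel n → Set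
f ≃ g = ∀ xs y → (f xs y → g xs y) × (g xs y → f xs y)

graph : ∀ {n} → (Vec ℕ n → ℕ) → PRel n
graph h xs y = h xs ≡ y

-- The class V is the union
-- of the images of the numberings (so it is countable).  φ is given on all
-- of ℕ for convenience; only its values on I n matter.
record Setting : Set₁ where
  field
    c  : ℕ → ℕ → ℕ
    p₁ : ℕ → ℕ
    p₂ : ℕ → ℕ
    c-surj : ∀ z → Σ ℕ λ a → Σ ℕ λ b → c a b ≡ z
    p₁-c : ∀ a b → p₁ (c a b) ≡ a
    p₂-c : ∀ a b → p₂ (c a b) ≡ b
    I  : ℕ → ℕ → Set
    φ  : (n e : ℕ) → PRel n
    φ-functional : ∀ n e xs y y′ → φ n e xs y → φ n e xs y′ → y ≡ y′

module _ (S : Setting) where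
  open Setting S

  IsV : (n : ℕ) → PRel n → Set
  IsV n f = Σ ℕ λ e → I n e × (φ n e ≃ f)

-- first k entries of a vector (padding with 0; only used when k ≤ length)
first : ∀ {m} (k : ℕ) → Vec ℕ m → Vec ℕ k
first zero    _        = []
first (suc k) []       = 0 ∷ first k []
first (suc k) (x ∷ xs) = x ∷ first k xs

maxV : ∀ {n} → Vec ℕ n → ℕ
maxV = foldr _ _⊔_ 0

module _ (S : Setting) where
  open Setting S

  BF : Set
  BF = (∀ n (i : Fin n) → IsV S n (graph (λ xs → lookup xs i)))
     × IsV S 2 (graph (λ { (a ∷ b ∷ []) → c a b }))
     × IsV S 1 (graph (λ { (z ∷ []) → p₁ z }))
     × IsV S 1 (graph (λ { (z ∷ []) → p₂ z }))

  compose : ∀ n (ms : Vec ℕ n) (e : ℕ) (es : Vec ℕ n) → PRel (maxV ms)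
  compose n ms e es xs y =
    Σ (Vec ℕ n) λ zs →
      (∀ i → φ (lookup ms i) (lookup es i) (first (lookup ms i) xs) (lookup zs i))
      × φ n e zs y

  Cm : Set₁
  Cm = ∀ n (ms : Vec ℕ n) → Σ (PRel (suc n)) λ s → IsV S (suc n) s ×
         (∀ e (es : Vec ℕ n) → I n e → (∀ i → I (lookup ms i) (lookup es i)) →
            Σ ℕ λ v → s (e ∷ es) v × I (maxV ms) v × (φ (maxV ms) v ≃ compose n ms e es))

  Cn : Set₁
  Cn = Σ (PRel 1) λ s → IsV S 1 s ×
         (∀ k → Σ ℕ λ v → s (k ∷ []) v × I 0 v × (φ 0 v ≃ graph (λ _ → k)))

  SMN : Set₁
  SMN = ∀ m n → Σ (PRel (suc m)) λ s → IsV S (suc m) s ×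
          (∀ (ks : Vec ℕ m) e → I (m + n) e →
             Σ ℕ λ v → s (e ∷ ks) v × I n v ×
               (φ n v ≃ (λ xs y → φ (m + n) e (cast (+-comm n m) (xs ++ ks)) y)))

module Submission where

-- Write N(k) ∈ 𝖨₀ for the index of the constant k given by (Cn), Pᵢ ∈ 𝖨ₙ for
-- an index of the projection Iⁿᵢ, and sub for the function s of (Cm) for the
-- arity profile (n,…,n,0,…,0) of length m+n.  Then
--     s(e,k₁,…,kₘ) = sub(e, P₁,…,Pₙ, N(k₁),…,N(kₘ))
-- satisfies φ_{s(e,k⃗)}(x⃗) ≃ φₑ(x₁,…,xₙ,k₁,…,kₘ).  This s is a V-function:
-- it is sub composed with the projection (e,k⃗) ↦ e, the constants Pᵢ and the
-- maps (e,k⃗) ↦ N(kⱼ), all total (m+1)-ary V-functions, so a second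
-- application of (Cm) yields an index for it.

open import Defs
open import Data.Nat using (ℕ; zero; suc; _+_; _⊔_; _≤_; z≤n; pred)
open import Data.Nat.Properties
  using (+-comm; ≤-refl; ⊔-assoc; ⊔-identityʳ; ⊔-lub; m≥n⇒m⊔n≡m; n≤0⇒n≡0)
open import Data.Fin using (Fin; zero; suc)
open import Data.Vec using (Vec; []; _∷_; head; lookup; _++_; cast; tabulate)
open import Data.Vec.Properties using (tabulate∘lookup; tabulate-cong)
open import Data.Vec.Relation.Unary.All using (All; []; _∷_; reduce)
open import Data.Vec.Relation.Unary.All.Properties using (++⁺; tabulate⁺)
open import Data.Product using (Σ; _×_; _,_; proj₁; proj₂)
open import Function using (id)
open import Relation.Binary.PropositionalEquality
  using (_≡_; refl; sym; trans; cong; cong₂; subst; module ≡-Reasoning)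

open ≡-Reasoning

≃-refl : ∀ {k} (f : PRel k) → f ≃ f
≃-refl f xs y = id , id

≃-trans : ∀ {k} {f g h : PRel k} → f ≃ g → g ≃ h → f ≃ h
≃-trans f≃g g≃h xs y =
  (λ p → proj₁ (g≃h xs y) (proj₁ (f≃g xs y) p)) ,
  (λ p → proj₂ (f≃g xs y) (proj₂ (g≃h xs y) p))

≃-args : ∀ {k n} (f : PRel k) {a b : Vec ℕ n → Vec ℕ k} →
         (∀ xs → a xs ≡ b xs) → (λ xs → f (a xs)) ≃ (λ xs → f (b xs))
≃-args f a≡b xs y rewrite a≡b xs = id , id

first-all : ∀ {n} (xs : Vec ℕ n) → first n xs ≡ xs
first-all []       = refl
first-all (x ∷ xs) = cong (x ∷_) (first-all xs)

maxV-cast : ∀ {a b} .(eq : a ≡ b) (v : Vec ℕ a) → maxV (cast eq v) ≡ maxV v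
maxV-cast {b = zero}  eq []      = refl
maxV-cast {b = suc b} eq (x ∷ v) = cong (x ⊔_) (maxV-cast (cong pred eq) v)

maxV-++ : ∀ {a b} (u : Vec ℕ a) (w : Vec ℕ b) → maxV (u ++ w) ≡ maxV u ⊔ maxV w
maxV-++ []      w = refl
maxV-++ (x ∷ u) w = begin
  x ⊔ maxV (u ++ w)        ≡⟨ cong (x ⊔_) (maxV-++ u w) ⟩
  x ⊔ (maxV u ⊔ maxV w)    ≡⟨ sym (⊔-assoc x (maxV u) (maxV w)) ⟩
  x ⊔ maxV u ⊔ maxV w      ∎

-- The constant vector (k,…,k) of length j; it is built by 'tabulate' so that
-- families over it can be built by 'tabulate⁺'.
constantVec : ∀ j → ℕ → Vec ℕ j
constantVec j k = tabulate (λ _ → k)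

maxV-constant : ∀ j k → maxV (constantVec j k) ≤ k
maxV-constant zero    k = z≤n
maxV-constant (suc j) k = ⊔-lub ≤-refl (maxV-constant j k)

maxV-constant-suc : ∀ j k → maxV (constantVec (suc j) k) ≡ k
maxV-constant-suc j k = m≥n⇒m⊔n≡m (maxV-constant j k)

maxV-constant-self : ∀ n → maxV (constantVec n n) ≡ n
maxV-constant-self zero    = refl
maxV-constant-self (suc n) = maxV-constant-suc n (suc n)

All-cast : ∀ {P : ℕ → Set} {a b} .(eq : a ≡ b) {v : Vec ℕ a} → All P v → All P (cast eq v)
All-cast {b = zero}  eq []       = []
All-cast {b = suc b} eq (p ∷ ps) = p ∷ All-cast (cong pred eq) ps

module _ {P : ℕ → Set} {B : Set} (f : ∀ {k} → P k → B) where

  reduce-cast : ∀ {a b} .(eq : a ≡ b) {v : Vec ℕ a} (ps : All P v) →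
                reduce f (All-cast eq ps) ≡ cast eq (reduce f ps)
  reduce-cast {b = zero}  eq []       = refl
  reduce-cast {b = suc b} eq (p ∷ ps) = cong (f p ∷_) (reduce-cast (cong pred eq) ps)

  reduce-++ : ∀ {a b} {u : Vec ℕ a} {w : Vec ℕ b} (ps : All P u) (qs : All P w) →
              reduce f (++⁺ ps qs) ≡ reduce f ps ++ reduce f qs
  reduce-++ []       qs = refl
  reduce-++ (p ∷ ps) qs = cong (f p ∷_) (reduce-++ ps qs)

  reduce-tabulate : ∀ {j} {g : Fin j → ℕ} (ps : ∀ i → P (g i)) →
                    reduce f (tabulate⁺ {P = P} ps) ≡ tabulate (λ i → f (ps i))
  reduce-tabulate {zero}  ps = refl
  reduce-tabulate {suc j} ps = cong (f (ps zero) ∷_) (reduce-tabulate (λ i → ps (suc i)))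

  reduce-blocks : ∀ {a b c} .(eq : a + b ≡ c) {g : Fin a → ℕ} {h : Fin b → ℕ}
                  (ps : ∀ i → P (g i)) (qs : ∀ j → P (h j)) →
                  reduce f (All-cast eq (++⁺ (tabulate⁺ {P = P} ps) (tabulate⁺ {P = P} qs)))
                  ≡ cast eq (tabulate (λ i → f (ps i)) ++ tabulate (λ j → f (qs j)))
  reduce-blocks eq ps qs = begin
    reduce f (All-cast eq (++⁺ (tabulate⁺ ps) (tabulate⁺ qs)))
      ≡⟨ reduce-cast eq (++⁺ (tabulate⁺ ps) (tabulate⁺ qs)) ⟩
    cast eq (reduce f (++⁺ (tabulate⁺ ps) (tabulate⁺ qs)))
      ≡⟨ cong (cast eq) (reduce-++ (tabulate⁺ ps) (tabulate⁺ qs)) ⟩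
    cast eq (reduce f (tabulate⁺ ps) ++ reduce f (tabulate⁺ qs))
      ≡⟨ cong (cast eq) (cong₂ _++_ (reduce-tabulate ps) (reduce-tabulate qs)) ⟩
    cast eq (tabulate (λ i → f (ps i)) ++ tabulate (λ j → f (qs j))) ∎

module Composition (S : Setting) (cm : Cm S) where
  open Setting S

  record TotalV (k : ℕ) : Set where
    field
      index    : ℕ
      fun      : Vec ℕ k → ℕ
      valid    : I k index
      computes : ∀ xs → φ k index xs (fun xs)
  open TotalV public

  indices : ∀ {n} {ms : Vec ℕ n} → All TotalV ms → Vec ℕ n
  indices = reduce index

  values : ∀ {n k} {ms : Vec ℕ n} → All TotalV ms → Vec ℕ k → Vec ℕ n
  values fs xs = reduce (λ {a} f → fun f (first a xs)) fs

  indices-valid : ∀ {n} {ms : Vec ℕ n} (fs : All TotalV ms) i →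
                  I (lookup ms i) (lookup (indices fs) i)
  indices-valid (f ∷ fs) zero    = valid f
  indices-valid (f ∷ fs) (suc i) = indices-valid fs i

  values-computed : ∀ {n k} {ms : Vec ℕ n} (fs : All TotalV ms) (xs : Vec ℕ k) i →
                    φ (lookup ms i) (lookup (indices fs) i)
                      (first (lookup ms i) xs) (lookup (values fs xs) i)
  values-computed (f ∷ fs) xs zero    = computes f _
  values-computed (f ∷ fs) xs (suc i) = values-computed fs xs i

  -- Since the inner functions are total and V-functions are single-valued,
  -- the intermediate values of a composition are forced to be 'values fs xs'.
  compose-forced : ∀ {n} {ms : Vec ℕ n} (fs : All TotalV ms) e →
                   compose S n ms e (indices fs) ≃ (λ xs y → φ n e (values fs xs) y)
  compose-forced {n} fs e xs y =
    (λ { (zs , zs-computed , e-at-zs) → subst (λ ws → φ n e ws y) (zs≡values zs zs-computed) e-at-zs }) ,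
    (λ e-at-values → values fs xs , values-computed fs xs , e-at-values)
    where
    zs≡values : ∀ zs → (∀ i → φ _ (lookup (indices fs) i) (first _ xs) (lookup zs i)) →
                zs ≡ values fs xs
    zs≡values zs zs-computed = begin
      zs                              ≡⟨ sym (tabulate∘lookup zs) ⟩
      tabulate (lookup zs)            ≡⟨ tabulate-cong (λ i →
        φ-functional _ _ _ _ _ (zs-computed i) (values-computed fs xs i)) ⟩
      tabulate (lookup (values fs xs)) ≡⟨ tabulate∘lookup (values fs xs) ⟩
      values fs xs                     ∎

  sub : ∀ {n} (ms : Vec ℕ n) → PRel (suc n)
  sub {n} ms = proj₁ (cm n ms)

  subIndex : ∀ {n} (ms : Vec ℕ n) → ℕ
  subIndex {n} ms = proj₁ (proj₁ (proj₂ (cm n ms)))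

  subIndex-valid : ∀ {n} (ms : Vec ℕ n) → I (suc n) (subIndex ms)
  subIndex-valid {n} ms = proj₁ (proj₂ (proj₁ (proj₂ (cm n ms))))

  subIndex-spec : ∀ {n} (ms : Vec ℕ n) → φ (suc n) (subIndex ms) ≃ sub ms
  subIndex-spec {n} ms = proj₂ (proj₂ (proj₁ (proj₂ (cm n ms))))

  substitute : ∀ {n k} {ms : Vec ℕ n} → maxV ms ≡ k → (fs : All TotalV ms) →
               ∀ e → I n e →
               Σ ℕ λ v → sub ms (e ∷ indices fs) v × I k v ×
                         (φ k v ≃ (λ xs y → φ n e (values fs xs) y))
  substitute {n} {ms = ms} refl fs e e-valid
    with proj₂ (proj₂ (cm n ms)) e (indices fs) e-valid (indices-valid fs)
  ... | v , v-sub , v-valid , v-spec = v , v-sub , v-valid , ≃-trans v-spec (compose-forced fs e)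

  composeTotal : ∀ {n k} {ms : Vec ℕ n} → TotalV n → (fs : All TotalV ms) → maxV ms ≡ k → TotalV k
  composeTotal g fs arity = record
    { index    = proj₁ composite
    ; fun      = λ xs → fun g (values fs xs)
    ; valid    = proj₁ (proj₂ (proj₂ composite))
    ; computes = λ xs → proj₂ (proj₂ (proj₂ (proj₂ composite)) xs _) (computes g (values fs xs))
    }
    where composite = substitute arity fs (index g) (valid g)

module Basic (S : Setting) (bf : BF S) (cm : Cm S) (cn : Cn S) where
  open Setting S
  open Composition S cm

  projection : ∀ n (i : Fin n) → TotalV n
  projection n i = record
    { index    = proj₁ (proj₁ bf n i)
    ; fun      = λ xs → lookup xs i
    ; valid    = proj₁ (proj₂ (proj₁ bf n i))
    ; computes = λ xs → proj₂ (proj₂ (proj₂ (proj₁ bf n i)) xs _) refl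
    }

  N : ℕ → ℕ
  N k = proj₁ (proj₂ (proj₂ cn) k)

  numeral : ℕ → TotalV 0
  numeral k = record
    { index    = N k
    ; fun      = λ _ → k
    ; valid    = proj₁ (proj₂ (proj₂ (proj₂ (proj₂ cn) k)))
    ; computes = λ xs → proj₂ (proj₂ (proj₂ (proj₂ (proj₂ (proj₂ cn) k))) xs k) refl
    }

  numeralMap : TotalV 1
  numeralMap = record
    { index    = proj₁ (proj₁ (proj₂ cn))
    ; fun      = λ xs → N (head xs)
    ; valid    = proj₁ (proj₂ (proj₁ (proj₂ cn)))
    ; computes = λ { (k ∷ []) → proj₂ (proj₂ (proj₂ (proj₁ (proj₂ cn))) (k ∷ []) (N k))
                                      (proj₁ (proj₂ (proj₂ (proj₂ cn) k))) }
    }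

  constant : ∀ m → ℕ → TotalV (suc m)
  constant m a = composeTotal (projection 2 zero) (numeral a ∷ projection (suc m) zero ∷ []) refl

  parameterNumeral : ∀ m → Fin m → TotalV (suc m)
  parameterNumeral m j = composeTotal numeralMap (projection (suc m) (suc j) ∷ []) refl

  parameterNumeral-value : ∀ m j e (ks : Vec ℕ m) →
                           fun (parameterNumeral m j) (first (suc m) (e ∷ ks)) ≡ N (lookup ks j)
  parameterNumeral-value m j e ks =
    cong (λ ws → N (lookup ws j)) (trans (first-all (first m ks)) (first-all ks))

module SMNConstruction (S : Setting) (bf : BF S) (cm : Cm S) (cn : Cn S) (m n : ℕ) where
  open Setting S
  open Composition S cm
  open Basic S bf cm cn

  swap : n + m ≡ m + n
  swap = +-comm n m

  -- First application: arity profile (n,…,n,0,…,0) and inner functions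
  -- I¹ₙ, …, Iⁿₙ, k₁, …, kₘ, so that the arguments become (x⃗, k⃗).
  profile : Vec ℕ (m + n)
  profile = cast swap (constantVec n n ++ constantVec m 0)

  profile-max : maxV profile ≡ n
  profile-max = begin
    maxV profile                                        ≡⟨ maxV-cast swap _ ⟩
    maxV (constantVec n n ++ constantVec m 0)          ≡⟨ maxV-++ (constantVec n n) _ ⟩
    maxV (constantVec n n) ⊔ maxV (constantVec m 0)    ≡⟨ cong₂ _⊔_ (maxV-constant-self n)
                                                             (n≤0⇒n≡0 (maxV-constant m 0)) ⟩
    n ⊔ 0                                               ≡⟨ ⊔-identityʳ n ⟩
    n                                                   ∎

  arguments : Vec ℕ m → All TotalV profile
  arguments ks = All-cast swap (++⁺ (tabulate⁺ (projection n))
                                    (tabulate⁺ (λ j → numeral (lookup ks j))))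

  values-arguments : ∀ ks (xs : Vec ℕ n) → values (arguments ks) xs ≡ cast swap (xs ++ ks)
  values-arguments ks xs = begin
    values (arguments ks) xs
      ≡⟨ reduce-blocks (λ {a} f → fun f (first a xs)) swap (projection n) (λ j → numeral (lookup ks j)) ⟩
    cast swap (tabulate (lookup (first n xs)) ++ tabulate (lookup ks))
      ≡⟨ cong (cast swap) (cong₂ _++_ (tabulate∘lookup (first n xs)) (tabulate∘lookup ks)) ⟩
    cast swap (first n xs ++ ks)
      ≡⟨ cong (λ ws → cast swap (ws ++ ks)) (first-all xs) ⟩
    cast swap (xs ++ ks) ∎

  -- Second application: the index s(e,k⃗) = sub profile (e, P⃗, N(k⃗)) as a
  -- composition of sub profile with (m+1)-ary total functions.
  builderArities : Vec ℕ (suc (m + n))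
  builderArities = suc m ∷ cast swap (constantVec n (suc m) ++ constantVec m (suc m))

  builderArities-max : maxV builderArities ≡ suc m
  builderArities-max = m≥n⇒m⊔n≡m (subst (_≤ suc m) (sym tail-max)
    (⊔-lub (maxV-constant n (suc m)) (maxV-constant m (suc m))))
    where
    tail-max : maxV (cast swap (constantVec n (suc m) ++ constantVec m (suc m)))
               ≡ maxV (constantVec n (suc m)) ⊔ maxV (constantVec m (suc m))
    tail-max = trans (maxV-cast swap _) (maxV-++ (constantVec n (suc m)) _)

  P : Fin n → ℕ
  P i = index (projection n i)

  builders : All TotalV builderArities
  builders = projection (suc m) zero ∷
             All-cast swap (++⁺ (tabulate⁺ (λ i → constant m (P i))) (tabulate⁺ (parameterNumeral m)))

  values-builders : ∀ e ks → values builders (e ∷ ks) ≡ e ∷ indices (arguments ks)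
  values-builders e ks = cong (e ∷_) (begin
    reduce value (All-cast swap (++⁺ (tabulate⁺ (λ i → constant m (P i)))
                                     (tabulate⁺ (parameterNumeral m))))
      ≡⟨ reduce-blocks value swap (λ i → constant m (P i)) (parameterNumeral m) ⟩
    cast swap (tabulate P ++ tabulate (λ j → value (parameterNumeral m j)))
      ≡⟨ cong (λ ws → cast swap (tabulate P ++ ws))
              (tabulate-cong (λ j → parameterNumeral-value m j e ks)) ⟩
    cast swap (tabulate P ++ tabulate (λ j → N (lookup ks j)))
      ≡⟨ sym (reduce-blocks index swap (projection n) (λ j → numeral (lookup ks j))) ⟩
    indices (arguments ks) ∎)
    where
    value : ∀ {a} → TotalV a → ℕ
    value {a} f = fun f (first a (e ∷ ks))

  smnComposite : Σ ℕ λ v → sub builderArities (subIndex profile ∷ indices builders) v × I (suc m) v ×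
                   (φ (suc m) v ≃ (λ xs y → φ (suc (m + n)) (subIndex profile) (values builders xs) y))
  smnComposite = substitute builderArities-max builders (subIndex profile) (subIndex-valid profile)

  smnIndex : ℕ
  smnIndex = proj₁ smnComposite

  smnIndex-valid : I (suc m) smnIndex
  smnIndex-valid = proj₁ (proj₂ (proj₂ smnComposite))

  smnIndex-computes : ∀ e ks v → sub profile (e ∷ indices (arguments ks)) v →
                      φ (suc m) smnIndex (e ∷ ks) v
  smnIndex-computes e ks v v-sub = proj₂ (proj₂ (proj₂ (proj₂ smnComposite)) (e ∷ ks) v)
    (subst (λ ws → φ (suc (m + n)) (subIndex profile) ws v) (sym (values-builders e ks))
           (proj₂ (subIndex-spec profile (e ∷ indices (arguments ks)) v) v-sub))

lemma2p3 : (S : Setting) → BF S → Cm S → Cn S → SMN S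
lemma2p3 S bf cm cn m n =
  φ (suc m) smnIndex , (smnIndex , smnIndex-valid , ≃-refl _) , smn-property
  where
  open Setting S
  open Composition S cm
  open SMNConstruction S bf cm cn m n

  smn-property : ∀ (ks : Vec ℕ m) e → I (m + n) e →
                 Σ ℕ λ v → φ (suc m) smnIndex (e ∷ ks) v × I n v ×
                   (φ n v ≃ (λ xs y → φ (m + n) e (cast (+-comm n m) (xs ++ ks)) y))
  smn-property ks e e-valid with substitute profile-max (arguments ks) e e-valid
  ... | v , v-sub , v-valid , v-spec =
    v , smnIndex-computes e ks v v-sub , v-valid ,
    ≃-trans v-spec (≃-args (φ (m + n) e) (values-arguments ks))
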